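{- For positive integers $m,n,p,q$, \[ \sum_{a=1}^{pm}\sum_{b=1}^{qn}\binom{pm+qm-a+b-1}{pm-a}\binom{pn+qn+a-b-1}{qn-b} =\frac{pqmn}{(p+q)(m+n)}\binom{pm+qm}{pm}\binom{pn+qn}{pn}. \]
   Context: Binomial coefficients $\binom{N}{k}$ with $N$ an integer are $\frac{N(N-1)\cdots(N-k+1)}{k!}$ for $k\ge0$ and $0$ for $k<0$. -}

module Defs where

open import Data.Nat using (ℕ; zero; suc; _+_)

sum1 : ℕ → (ℕ → ℕ) → ℕ
sum1 zero    f = 0
sum1 (suc n) f = sum1 n f + f (suc n)

{-# OPTIONS --safe #-}
-- With X = pm, Y = qm, U = pn, V = qn one has XV = YU and (p+q)(m+n) = X+Y+U+V, and the identity
-- (X+Y+U+V) S = XV C(X+Y,X) C(U+V,U) holds for every X, Y, U, V with XV = YU.  Write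
-- paths a b = C(a+b,a).  Reindexed, S is a sum over antidiagonals of products of two such numbers;
-- a Vandermonde-type exchange of the inner sum followed by a regrouping turns it into the single sum
-- Σ_{h+r=X-1} (r+1) paths h (Y-1) paths (V-1) (r+U+1).  Precisely because XV = YU, (Y+V) times its
-- summand is H(h+1,r) - H(h,r+1) for H(h,s) = h paths h (Y-1) · V paths (s+U) V, so the sum telescopes
-- to (Y+V) S = X paths X (Y-1) · V paths U V, and absorption gives the closed form.
module Submission where

open import Defs
open import Data.Nat using (ℕ; suc; _+_; _*_; _∸_)
open import Data.Nat.Combinatorics using (_C_)
open import Relation.Binary.PropositionalEquality using (_≡_)
open import Data.Nat using (zero; _≤_; _!)
open import Data.Nat.Combinatorics
  using (nCk≡nC[n∸k]; nCk+nC[k+1]≡[n+1]C[k+1]; nCk≡n!/k![n-k]!; k![n∸k]!∣n!)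
open import Data.Nat.DivMod using (_/_; m/n*n≡m)
open import Data.Nat.Properties
open import Data.Nat.Tactic.RingSolver using (solve-∀)
open import Relation.Binary.PropositionalEquality using (refl; sym; trans; cong; cong₂; module ≡-Reasoning)
open import Algebra.Properties.CommutativeSemigroup +-commutativeSemigroup using (interchange)
open ≡-Reasoning

nCk*k![n∸k]!≡n! : ∀ {n k} → k ≤ n → (n C k) * (k ! * (n ∸ k) !) ≡ n !
nCk*k![n∸k]!≡n! {n} {k} k≤n = begin
  (n C k) * (k ! * (n ∸ k) !)                  ≡⟨ cong (_* (k ! * (n ∸ k) !)) (nCk≡n!/k![n-k]! k≤n) ⟩
  (n ! / (k ! * (n ∸ k) !)) * (k ! * (n ∸ k) !) ≡⟨ m/n*n≡m (k![n∸k]!∣n! k≤n) ⟩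
  n !                                          ∎
  where
  instance
    _ = k !* (n ∸ k) !≢0

paths : ℕ → ℕ → ℕ
paths a b = (a + b) C a

paths-sym : ∀ a b → paths a b ≡ paths b a
paths-sym a b = begin
  (a + b) C a           ≡⟨ nCk≡nC[n∸k] (m≤m+n a b) ⟩
  (a + b) C (a + b ∸ a) ≡⟨ cong ((a + b) C_) (m+n∸m≡n a b) ⟩
  (a + b) C b           ≡⟨ cong (_C b) (+-comm a b) ⟩
  (b + a) C b           ∎

paths-pascal : ∀ a b → paths (suc a) (suc b) ≡ paths a (suc b) + paths (suc a) b
paths-pascal a b = begin
  suc (a + suc b) C suc a                   ≡⟨ nCk+nC[k+1]≡[n+1]C[k+1] (a + suc b) a ⟨
  (a + suc b) C a + (a + suc b) C suc a     ≡⟨ cong (λ n → (a + suc b) C a + n C suc a) (+-suc a b) ⟩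
  (a + suc b) C a + suc (a + b) C suc a     ∎

paths-factorials : ∀ a b → paths a b * (a ! * b !) ≡ (a + b) !
paths-factorials a b = begin
  paths a b * (a ! * b !)           ≡⟨ cong (λ c → paths a b * (a ! * c !)) (m+n∸m≡n a b) ⟨
  paths a b * (a ! * (a + b ∸ a) !) ≡⟨ nCk*k![n∸k]!≡n! (m≤m+n a b) ⟩
  (a + b) !                         ∎

paths-absorptionˡ : ∀ a b → suc a * paths (suc a) b ≡ suc (a + b) * paths a b
paths-absorptionˡ a b = *-cancelʳ-≡ _ _ (a ! * b !) {{a !* b !≢0}} (begin
  suc a * paths (suc a) b * (a ! * b !)   ≡⟨ regroup (suc a) (paths (suc a) b) (a !) (b !) ⟩
  paths (suc a) b * (suc a ! * b !)       ≡⟨ paths-factorials (suc a) b ⟩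
  suc (a + b) * (a + b) !                 ≡⟨ cong (suc (a + b) *_) (paths-factorials a b) ⟨
  suc (a + b) * (paths a b * (a ! * b !)) ≡⟨ *-assoc (suc (a + b)) (paths a b) (a ! * b !) ⟨
  suc (a + b) * paths a b * (a ! * b !)   ∎)
  where
  regroup : ∀ s c f g → s * c * (f * g) ≡ c * (s * f * g)
  regroup = solve-∀

paths-absorptionʳ : ∀ a b → suc b * paths a (suc b) ≡ suc (a + b) * paths a b
paths-absorptionʳ a b = begin
  suc b * paths a (suc b)  ≡⟨ cong (suc b *_) (paths-sym a (suc b)) ⟩
  suc b * paths (suc b) a  ≡⟨ paths-absorptionˡ b a ⟩
  suc (b + a) * paths b a  ≡⟨ cong₂ _*_ (cong suc (+-comm b a)) (paths-sym b a) ⟩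
  suc (a + b) * paths a b  ∎

antidiagonal-sum : ℕ → (ℕ → ℕ → ℕ) → ℕ
antidiagonal-sum zero    F = F 0 0
antidiagonal-sum (suc n) F = F 0 (suc n) + antidiagonal-sum n (λ k l → F (suc k) l)

infix 5 antidiagonal-sum
syntax antidiagonal-sum n (λ k l → e) = ∑[ k + l ≡ n ] e

antidiagonal-cong : ∀ n {F G : ℕ → ℕ → ℕ} → (∀ k l → k + l ≡ n → F k l ≡ G k l) →
                    antidiagonal-sum n F ≡ antidiagonal-sum n G
antidiagonal-cong zero    F≗G = F≗G 0 0 refl
antidiagonal-cong (suc n) F≗G =
  cong₂ _+_ (F≗G 0 (suc n) refl) (antidiagonal-cong n (λ k l e → F≗G (suc k) l (cong suc e)))

antidiagonal-last : ∀ n F → antidiagonal-sum (suc n) F ≡ (∑[ k + l ≡ n ] F k (suc l)) + F (suc n) 0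
antidiagonal-last zero    F = refl
antidiagonal-last (suc n) F = begin
  F 0 (suc (suc n)) + antidiagonal-sum (suc n) (λ k l → F (suc k) l)
    ≡⟨ cong (F 0 (suc (suc n)) +_) (antidiagonal-last n (λ k l → F (suc k) l)) ⟩
  F 0 (suc (suc n)) + ((∑[ k + l ≡ n ] F (suc k) (suc l)) + F (suc (suc n)) 0)
    ≡⟨ +-assoc (F 0 (suc (suc n))) _ _ ⟨
  (∑[ k + l ≡ suc n ] F k (suc l)) + F (suc (suc n)) 0 ∎

antidiagonal-+ : ∀ n F G → (∑[ k + l ≡ n ] F k l + G k l) ≡ antidiagonal-sum n F + antidiagonal-sum n G
antidiagonal-+ zero    F G = refl
antidiagonal-+ (suc n) F G = begin
  (F 0 (suc n) + G 0 (suc n)) + (∑[ k + l ≡ n ] F (suc k) l + G (suc k) l)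
    ≡⟨ cong ((F 0 (suc n) + G 0 (suc n)) +_) (antidiagonal-+ n _ _) ⟩
  (F 0 (suc n) + G 0 (suc n)) + (antidiagonal-sum n _ + antidiagonal-sum n _)
    ≡⟨ interchange (F 0 (suc n)) (G 0 (suc n)) _ _ ⟩
  antidiagonal-sum (suc n) F + antidiagonal-sum (suc n) G ∎

antidiagonal-*ˡ : ∀ n c F → (∑[ k + l ≡ n ] c * F k l) ≡ c * antidiagonal-sum n F
antidiagonal-*ˡ zero    c F = refl
antidiagonal-*ˡ (suc n) c F =
  trans (cong (c * F 0 (suc n) +_) (antidiagonal-*ˡ n c _)) (sym (*-distribˡ-+ c _ _))

sum1-antidiagonal : ∀ n f → sum1 (suc n) f ≡ ∑[ k + l ≡ n ] f (suc k)
sum1-antidiagonal zero    f = refl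
sum1-antidiagonal (suc n) f =
  trans (cong (_+ f (suc (suc n))) (sum1-antidiagonal n f)) (sym (antidiagonal-last n (λ k _ → f (suc k))))

sum1-zero : ∀ n → sum1 n (λ _ → 0) ≡ 0
sum1-zero zero    = refl
sum1-zero (suc n) = trans (+-identityʳ (sum1 n (λ _ → 0))) (sum1-zero n)

antidiagonal-telescope : ∀ n (H F : ℕ → ℕ → ℕ) →
                         (∀ h r → h + r ≡ n → H (suc h) r ≡ H h (suc r) + F h r) →
                         H (suc n) 0 ≡ H 0 (suc n) + antidiagonal-sum n F
antidiagonal-telescope zero    H F step = step 0 0 refl
antidiagonal-telescope (suc n) H F step = begin
  H (suc (suc n)) 0
    ≡⟨ antidiagonal-telescope n (λ h r → H (suc h) r) (λ h r → F (suc h) r)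
                                (λ h r e → step (suc h) r (cong suc e)) ⟩
  H 1 (suc n) + (∑[ h + r ≡ n ] F (suc h) r)
    ≡⟨ cong (_+ _) (step 0 (suc n) refl) ⟩
  (H 0 (suc (suc n)) + F 0 (suc n)) + (∑[ h + r ≡ n ] F (suc h) r)
    ≡⟨ +-assoc (H 0 (suc (suc n))) _ _ ⟩
  H 0 (suc (suc n)) + antidiagonal-sum (suc n) F ∎

antidiagonal-nested : ∀ N F → (∑[ a + i ≡ N ] ∑[ h + g ≡ i ] F h (a + g)) ≡ (∑[ h + r ≡ N ] suc r * F h r)
antidiagonal-nested zero    F = sym (+-identityʳ (F 0 0))
antidiagonal-nested (suc N) F = begin
  antidiagonal-sum (suc N) F + (∑[ a + i ≡ N ] ∑[ h + g ≡ i ] F′ h (a + g))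
    ≡⟨ cong₂ _+_ (antidiagonal-last N F) (antidiagonal-nested N F′) ⟩
  (antidiagonal-sum N F′ + F (suc N) 0) + (∑[ h + r ≡ N ] suc r * F′ h r)
    ≡⟨ +-rearrange (antidiagonal-sum N F′) (F (suc N) 0) _ ⟩
  (antidiagonal-sum N F′ + (∑[ h + r ≡ N ] suc r * F′ h r)) + 1 * F (suc N) 0
    ≡⟨ cong (_+ 1 * F (suc N) 0) (antidiagonal-+ N F′ (λ h r → suc r * F′ h r)) ⟨
  (∑[ h + r ≡ N ] suc (suc r) * F h (suc r)) + 1 * F (suc N) 0
    ≡⟨ antidiagonal-last N (λ h r → suc r * F h r) ⟨
  (∑[ h + r ≡ suc N ] suc r * F h r) ∎
  where
  F′ : ℕ → ℕ → ℕ
  F′ h r = F h (suc r)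
  +-rearrange : ∀ a b c → (a + b) + c ≡ (a + c) + (b + 0)
  +-rearrange = solve-∀

paths-hockey-stick : ∀ n b → (∑[ d + j ≡ n ] paths j b) ≡ paths n (suc b)
paths-hockey-stick zero    b = refl
paths-hockey-stick (suc n) b = begin
  paths (suc n) b + (∑[ d + j ≡ n ] paths j b) ≡⟨ cong (paths (suc n) b +_) (paths-hockey-stick n b) ⟩
  paths (suc n) b + paths n (suc b)           ≡⟨ +-comm (paths (suc n) b) (paths n (suc b)) ⟩
  paths n (suc b) + paths (suc n) b           ≡⟨ paths-pascal n b ⟨
  paths (suc n) (suc b)                       ∎

paths-exchange-step : ∀ z a b n →
  (∑[ d + j ≡ n ] paths (suc a) (suc (d + z)) * paths j b) ≡
  (∑[ d + j ≡ n ] paths a (suc (d + z)) * paths j (suc b)) + paths (suc a) z * paths n (suc b)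
paths-exchange-step z a b zero    =
  trans (cong (_* 1) (paths-pascal a z)) (*-distribʳ-+ 1 (paths a (suc z)) (paths (suc a) z))
paths-exchange-step z a b (suc n) = begin
  P₁ * paths (suc n) b + (∑[ d + j ≡ n ] paths (suc a) (suc (suc d + z)) * paths j b)
    ≡⟨ cong (P₁ * paths (suc n) b +_) (trans (shift (suc a) b) (paths-exchange-step (suc z) a b n)) ⟩
  P₁ * paths (suc n) b + (T + P₁ * paths n (suc b))
    ≡⟨ collect P₁ (paths (suc n) b) T (paths n (suc b)) ⟩
  P₁ * (paths n (suc b) + paths (suc n) b) + T
    ≡⟨ cong (_+ T) (cong₂ _*_ (paths-pascal a z) (sym (paths-pascal n b))) ⟩
  (paths a (suc z) + paths (suc a) z) * W + T
    ≡⟨ split (paths a (suc z)) (paths (suc a) z) W T ⟩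
  (paths a (suc z) * W + T) + paths (suc a) z * W
    ≡⟨ cong (λ t → (paths a (suc z) * W + t) + paths (suc a) z * W) (shift a (suc b)) ⟨
  (∑[ d + j ≡ suc n ] paths a (suc (d + z)) * paths j (suc b)) + paths (suc a) z * W ∎
  where
  P₁ W T : ℕ
  P₁ = paths (suc a) (suc z)
  W  = paths (suc n) (suc b)
  T  = ∑[ d + j ≡ n ] paths a (suc (d + suc z)) * paths j (suc b)
  shift : ∀ a b → (∑[ d + j ≡ n ] paths a (suc (suc d + z)) * paths j b)
                ≡ (∑[ d + j ≡ n ] paths a (suc (d + suc z)) * paths j b)
  shift a b = antidiagonal-cong n (λ d j _ → cong (λ c → paths a (suc c) * paths j b) (sym (+-suc d z)))
  collect : ∀ x p t q → x * p + (t + x * q) ≡ x * (q + p) + t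
  collect = solve-∀
  split : ∀ p q w t → (p + q) * w + t ≡ (p * w + t) + q * w
  split = solve-∀

paths-exchange : ∀ z a b n →
  (∑[ d + j ≡ n ] paths a (suc (d + z)) * paths j b) ≡ (∑[ h + g ≡ a ] paths h z * paths n (suc (g + b)))
paths-exchange z zero    b n = begin
  (∑[ d + j ≡ n ] 1 * paths j b) ≡⟨ antidiagonal-cong n (λ d j _ → *-identityˡ (paths j b)) ⟩
  (∑[ d + j ≡ n ] paths j b)     ≡⟨ paths-hockey-stick n b ⟩
  paths n (suc b)                ≡⟨ *-identityˡ (paths n (suc b)) ⟨
  1 * paths n (suc b)            ∎
paths-exchange z (suc a) b n = begin
  (∑[ d + j ≡ n ] paths (suc a) (suc (d + z)) * paths j b)
    ≡⟨ paths-exchange-step z a b n ⟩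
  (∑[ d + j ≡ n ] paths a (suc (d + z)) * paths j (suc b)) + R
    ≡⟨ cong (_+ R) (paths-exchange z a (suc b) n) ⟩
  (∑[ h + g ≡ a ] paths h z * paths n (suc (g + suc b))) + R
    ≡⟨ cong (_+ R) (antidiagonal-cong a (λ h g _ → cong (λ c → paths h z * paths n (suc c)) (+-suc g b))) ⟩
  (∑[ h + g ≡ a ] paths h z * paths n (suc (suc g + b))) + R
    ≡⟨ antidiagonal-last a (λ h g → paths h z * paths n (suc (g + b))) ⟨
  (∑[ h + g ≡ suc a ] paths h z * paths n (suc (g + b))) ∎
  where
  R : ℕ
  R = paths (suc a) z * paths n (suc b)

doubleSum : ℕ → ℕ → ℕ → ℕ → ℕ
doubleSum X Y U V = sum1 X (λ a → sum1 V (λ b →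
  ((X + Y + b ∸ 1 ∸ a) C (X ∸ a)) * ((U + V + a ∸ b ∸ 1) C (V ∸ b))))

doubleSum-antidiagonal : ∀ x y u v → doubleSum (suc x) (suc y) u (suc v) ≡
  (∑[ k + l ≡ x ] ∑[ k′ + l′ ≡ v ] paths l (suc (k′ + y)) * paths l′ (k + u))
doubleSum-antidiagonal x y u v =
  trans (sum1-antidiagonal x _) (antidiagonal-cong x λ k l k+l≡x →
  trans (sum1-antidiagonal v _) (antidiagonal-cong v λ k′ l′ k′+l′≡v →
  summand k l k′ l′ k+l≡x k′+l′≡v))
  where
  summand : ∀ k l k′ l′ → k + l ≡ x → k′ + l′ ≡ v →
    ((suc x + suc y + suc k′ ∸ 1 ∸ suc k) C (suc x ∸ suc k)) *
    ((u + suc v + suc k ∸ suc k′ ∸ 1) C (suc v ∸ suc k′))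
    ≡ paths l (suc (k′ + y)) * paths l′ (k + u)
  summand k l k′ l′ refl refl = cong₂ _*_
    (cong₂ _C_ (trans (cong (_∸ suc k) (first k l y k′)) (m+n∸m≡n (suc k) _)) (m+n∸m≡n k l))
    (cong₂ _C_ (cong (_∸ 1) (trans (cong (_∸ suc k′) (second u k′ l′ k)) (m+n∸m≡n (suc k′) _)))
               (m+n∸m≡n k′ l′))
    where
    first : ∀ k l y k′ → k + l + suc y + suc k′ ≡ suc k + (l + suc (k′ + y))
    first = solve-∀
    second : ∀ u k′ l′ k → u + suc (k′ + l′) + suc k ≡ suc k′ + suc (l′ + (k + u))
    second = solve-∀

doubleSum-single : ∀ x y u v → doubleSum (suc x) (suc y) u (suc v) ≡
  (∑[ h + r ≡ x ] suc r * (paths h y * paths v (suc (r + u))))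
doubleSum-single x y u v = begin
  doubleSum (suc x) (suc y) u (suc v)
    ≡⟨ doubleSum-antidiagonal x y u v ⟩
  (∑[ k + l ≡ x ] ∑[ k′ + l′ ≡ v ] paths l (suc (k′ + y)) * paths l′ (k + u))
    ≡⟨ antidiagonal-cong x (λ k l _ → paths-exchange y l (k + u) v) ⟩
  (∑[ k + l ≡ x ] ∑[ h + g ≡ l ] paths h y * paths v (suc (g + (k + u))))
    ≡⟨ antidiagonal-cong x (λ k l _ → antidiagonal-cong l (λ h g _ →
         cong (λ c → paths h y * paths v (suc c)) (reassociate g k u))) ⟩
  (∑[ k + l ≡ x ] ∑[ h + g ≡ l ] paths h y * paths v (suc (k + g + u)))
    ≡⟨ antidiagonal-nested x (λ h r → paths h y * paths v (suc (r + u))) ⟩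
  (∑[ h + r ≡ x ] suc r * (paths h y * paths v (suc (r + u)))) ∎
  where
  reassociate : ∀ g k u → g + (k + u) ≡ k + g + u
  reassociate = solve-∀

telescoping-step : ∀ x y u v → suc x * suc v ≡ suc y * u → ∀ h r → h + r ≡ x →
  (suc h * paths (suc h) y) * (suc v * paths (r + u) (suc v)) ≡
  (h * paths h y) * (suc v * paths (suc r + u) (suc v)) +
  (suc y + suc v) * (suc r * (paths h y * paths v (suc (r + u))))
telescoping-step x y u v xv≡yu h r refl = begin
  (suc h * paths (suc h) y) * (suc v * paths (r + u) (suc v))
    ≡⟨ cong₂ _*_ (paths-absorptionˡ h y)
                 (trans (paths-absorptionʳ (r + u) v) (sym (paths-absorptionˡ (r + u) v))) ⟩
  (suc (h + y) * A) * (suc (r + u) * B)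
    ≡⟨ factor (suc (h + y)) (suc (r + u)) A B ⟩
  (suc (h + y) * suc (r + u)) * (A * B)
    ≡⟨ cong (_* (A * B)) coefficients ⟩
  (h * suc (suc (r + u) + v) + (suc y + suc v) * suc r) * (A * B)
    ≡⟨ distribute h (suc (suc (r + u) + v)) (suc y + suc v) (suc r) A B ⟩
  (h * A) * (suc (suc (r + u) + v) * B) + (suc y + suc v) * (suc r * (A * B))
    ≡⟨ cong₂ (λ s t → (h * A) * s + (suc y + suc v) * (suc r * (A * t)))
             (paths-absorptionʳ (suc (r + u)) v) (paths-sym v (suc (r + u))) ⟨
  (h * A) * (suc v * paths (suc r + u) (suc v)) + (suc y + suc v) * (suc r * (A * paths v (suc (r + u)))) ∎
  where
  A B : ℕ
  A = paths h y
  B = paths (suc (r + u)) v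
  factor : ∀ c d a b → (c * a) * (d * b) ≡ (c * d) * (a * b)
  factor = solve-∀
  distribute : ∀ h c e s a b → (h * c + e * s) * (a * b) ≡ (h * a) * (c * b) + e * (s * (a * b))
  distribute = solve-∀
  coefficients-with-defect : ∀ h r u v y →
    suc (h + y) * suc (r + u) + suc (h + r) * suc v ≡ (h * suc (suc (r + u) + v) + (suc y + suc v) * suc r) + suc y * u
  coefficients-with-defect = solve-∀
  coefficients : suc (h + y) * suc (r + u) ≡ h * suc (suc (r + u) + v) + (suc y + suc v) * suc r
  coefficients = +-cancelʳ-≡ (suc y * u) _ _
    (trans (cong (suc (h + y) * suc (r + u) +_) (sym xv≡yu)) (coefficients-with-defect h r u v y))

doubleSum-telescoped : ∀ x y u v → suc x * suc v ≡ suc y * u →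
  (suc y + suc v) * doubleSum (suc x) (suc y) u (suc v) ≡ (suc x * paths (suc x) y) * (suc v * paths u (suc v))
doubleSum-telescoped x y u v xv≡yu = begin
  (suc y + suc v) * doubleSum (suc x) (suc y) u (suc v)
    ≡⟨ cong ((suc y + suc v) *_) (doubleSum-single x y u v) ⟩
  (suc y + suc v) * (∑[ h + r ≡ x ] suc r * (paths h y * paths v (suc (r + u))))
    ≡⟨ antidiagonal-*ˡ x (suc y + suc v) _ ⟨
  (∑[ h + r ≡ x ] (suc y + suc v) * (suc r * (paths h y * paths v (suc (r + u)))))
    ≡⟨ antidiagonal-telescope x H _ (telescoping-step x y u v xv≡yu) ⟨
  H (suc x) 0 ∎
  where
  H : ℕ → ℕ → ℕ
  H h s = (h * paths h y) * (suc v * paths (s + u) (suc v))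

doubleSum-closed-form : ∀ X Y U V → X * V ≡ Y * U →
  (X + Y + U + V) * doubleSum X Y U V ≡ X * V * (((X + Y) C X) * ((U + V) C U))
doubleSum-closed-form zero Y U V _ = *-zeroʳ (Y + U + V)
doubleSum-closed-form (suc x) Y U zero _ = begin
  (suc x + Y + U + 0) * sum1 (suc x) (λ _ → 0) ≡⟨ cong ((suc x + Y + U + 0) *_) (sum1-zero (suc x)) ⟩
  (suc x + Y + U + 0) * 0                      ≡⟨ *-zeroʳ (suc x + Y + U + 0) ⟩
  0                                            ≡⟨ cong (_* K) (*-zeroʳ (suc x)) ⟨
  suc x * 0 * K                                ∎
  where
  K : ℕ
  K = ((suc x + Y) C suc x) * ((U + 0) C U)
doubleSum-closed-form (suc x) zero    U (suc v) ()
doubleSum-closed-form (suc x) (suc y) U (suc v) xv≡yu = *-cancelˡ-≡ _ _ Y (begin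
  Y * ((X + Y + U + V) * S)                    ≡⟨ *-assoc Y (X + Y + U + V) S ⟨
  (Y * (X + Y + U + V)) * S                    ≡⟨ cong (_* S) weights ⟨
  ((X + Y) * (Y + V)) * S                      ≡⟨ *-assoc (X + Y) (Y + V) S ⟩
  (X + Y) * ((Y + V) * S)                      ≡⟨ cong ((X + Y) *_) (doubleSum-telescoped x y U v xv≡yu) ⟩
  (X + Y) * ((X * paths X y) * (V * paths U V)) ≡⟨ pull-out (X + Y) X V (paths X y) (paths U V) ⟩
  X * V * ((X + Y) * paths X y * paths U V)     ≡⟨ cong (λ t → X * V * (t * paths U V)) absorbed ⟩
  X * V * (Y * paths X Y * paths U V)           ≡⟨ push-in X V Y (paths X Y) (paths U V) ⟩
  Y * (X * V * (paths X Y * paths U V))         ∎)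
  where
  X Y V S : ℕ
  X = suc x
  Y = suc y
  V = suc v
  S = doubleSum X Y U V
  weights-with-defect : ∀ X Y U V → (X + Y) * (Y + V) + Y * U ≡ Y * (X + Y + U + V) + X * V
  weights-with-defect = solve-∀
  weights : (X + Y) * (Y + V) ≡ Y * (X + Y + U + V)
  weights = +-cancelʳ-≡ (Y * U) _ _
    (trans (weights-with-defect X Y U V) (cong (Y * (X + Y + U + V) +_) xv≡yu))
  absorbed : (X + Y) * paths X y ≡ Y * paths X Y
  absorbed = trans (cong (_* paths X y) (+-suc X y)) (sym (paths-absorptionʳ X y))
  pull-out : ∀ s x v a b → s * ((x * a) * (v * b)) ≡ x * v * (s * a * b)
  pull-out = solve-∀
  push-in : ∀ x v y a b → x * v * (y * a * b) ≡ y * (x * v * (a * b))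
  push-in = solve-∀

mainTheorem3 : (m n p q : ℕ) →
  ((suc p) + (suc q)) * ((suc m) + (suc n)) *
    sum1 ((suc p) * (suc m)) (λ a → sum1 ((suc q) * (suc n)) (λ b →
      (((suc p) * (suc m) + (suc q) * (suc m) + b ∸ 1 ∸ a) C ((suc p) * (suc m) ∸ a)) *
      (((suc p) * (suc n) + (suc q) * (suc n) + a ∸ b ∸ 1) C ((suc q) * (suc n) ∸ b))))
  ≡ (suc p) * (suc q) * (suc m) * (suc n) * ((((suc p) * (suc m) + (suc q) * (suc m)) C ((suc p) * (suc m))) * (((suc p) * (suc n) + (suc q) * (suc n)) C ((suc p) * (suc n))))
mainTheorem3 m n p q = begin
  (suc p + suc q) * (suc m + suc n) * doubleSum X Y U V
    ≡⟨ cong (_* doubleSum X Y U V) (expand (suc p) (suc q) (suc m) (suc n)) ⟩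
  (X + Y + U + V) * doubleSum X Y U V
    ≡⟨ doubleSum-closed-form X Y U V (cross (suc p) (suc q) (suc m) (suc n)) ⟩
  X * V * K
    ≡⟨ cong (_* K) (reorder (suc p) (suc q) (suc m) (suc n)) ⟩
  suc p * suc q * suc m * suc n * K ∎
  where
  X Y U V K : ℕ
  X = suc p * suc m
  Y = suc q * suc m
  U = suc p * suc n
  V = suc q * suc n
  K = ((X + Y) C X) * ((U + V) C U)
  expand : ∀ p q m n → (p + q) * (m + n) ≡ p * m + q * m + p * n + q * n
  expand = solve-∀
  cross : ∀ p q m n → p * m * (q * n) ≡ q * m * (p * n)
  cross = solve-∀
  reorder : ∀ p q m n → p * m * (q * n) ≡ p * q * m * n
  reorder = solve-∀
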